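{- As formal power series in independent variables $q,a,b,t$, \[ \sum_{\substack{(\pi_1,\pi_2)\in \mathcal{D}\times\mathcal{P}\\ l(\pi_2)\leq \nu(\pi_1)}} t^{\nu(\pi_1)+\nu(\pi_2)}a^{\nu(\pi_2)}b^{\nu(\pi_1)}q^{|\pi_1|+|\pi_2|} \;=\; \sum_{\substack{(\pi^*_1,\pi^*_2)\in\mathcal{D}\times\mathcal{P}\\ d(\pi^*_2)\leq r(\pi^*_1)}} t^{\nu(\pi^*_1)+\nu(\pi^*_2)}a^{\nu(\pi^*_2)}b^{\nu(\pi^*_1)}q^{|\pi^*_1|+|\pi^*_2|}. \]
   Context: A partition is a finite non-increasing sequence of positive integers (the empty partition allowed). $\mathcal{P}$ is the set of all partitions and $\mathcal{D}$ the set of partitions into distinct parts. For a partition $\pi$: $|\pi|$ is the sum of parts, $\nu(\pi)$ the number of parts, $l(\pi)$ the largest part ($0$ for the empty partition), $d(\pi)$ the side length of the Durfee square (the largest $d$ such that $\pi$ has at least $d$ parts each $\ge d$), and $r(\pi)$ the largest $r\ge0$ such that each of $1,2,\dots,r$ is a part of $\pi$. -}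

module Defs where

open import Data.Nat using (ℕ; zero; suc; _+_; _≤_; _<_; _≥_; _>_; _⊔_; _≤ᵇ_; _≡ᵇ_)
open import Data.Bool using (Bool; true; false; if_then_else_; _∧_)
open import Data.List using (List; []; _∷_; length; foldr; filter)
open import Data.Nat.ListAction using (sum)
open import Data.Bool.ListAction using (any)
open import Data.List.Relation.Unary.All using (All)
open import Data.List.Relation.Unary.Linked using (Linked)
open import Data.Product using (Σ; _×_)
open import Relation.Binary.PropositionalEquality using (_≡_)

IsPartition : List ℕ → Set
IsPartition xs = All (λ x → 1 ≤ x) xs × Linked _≥_ xs

IsDistinctPartition : List ℕ → Set
IsDistinctPartition xs = All (λ x → 1 ≤ x) xs × Linked _>_ xs

size : List ℕ → ℕ
size = sum

nparts : List ℕ → ℕ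
nparts = length

-- l(π) : largest part (0 for the empty partition)
largest : List ℕ → ℕ
largest = foldr _⊔_ 0

countGe : ℕ → List ℕ → ℕ
countGe d xs = length (filter (λ x → d Data.Nat.≤? x) xs)

-- d(π) : largest d (necessarily ≤ ν(π)) such that π has at least d parts ≥ d.
-- Computed by scanning d downward from ν(π); d = 0 always qualifies.
durfeeFrom : ℕ → List ℕ → ℕ
durfeeFrom zero    xs = zero
durfeeFrom (suc d) xs = if suc d ≤ᵇ countGe (suc d) xs then suc d else durfeeFrom d xs

durfee : List ℕ → ℕ
durfee xs = durfeeFrom (length xs) xs

isPart : ℕ → List ℕ → Bool
isPart k xs = any (λ y → k ≡ᵇ y) xs

allUpTo : ℕ → List ℕ → Bool
allUpTo zero    xs = true
allUpTo (suc r) xs = isPart (suc r) xs ∧ allUpTo r xs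

-- r(π) : largest r ≥ 0 such that each of 1,…,r is a part of π
-- (necessarily r ≤ ν(π)); scan r downward from ν(π).
runFrom : ℕ → List ℕ → ℕ
runFrom zero    xs = zero
runFrom (suc r) xs = if allUpTo (suc r) xs then suc r else runFrom r xs

run : List ℕ → ℕ
run xs = runFrom (length xs) xs

-- Pairs (π₁, π₂) ∈ 𝒟 × 𝒫 with l(π₂) ≤ ν(π₁), contributing to the coefficient
-- of t^k a^i b^j q^n on the left-hand side.
LHS : (n k i j : ℕ) → Set
LHS n k i j =
  Σ (List ℕ) λ π₁ → Σ (List ℕ) λ π₂ →
    IsDistinctPartition π₁ × IsPartition π₂ × largest π₂ ≤ nparts π₁ ×
    (nparts π₁ + nparts π₂ ≡ k) × (nparts π₂ ≡ i) × (nparts π₁ ≡ j) ×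
    (size π₁ + size π₂ ≡ n)

-- Pairs (π₁*, π₂*) ∈ 𝒟 × 𝒫 with d(π₂*) ≤ r(π₁*), contributing to the coefficient
-- of t^k a^i b^j q^n on the right-hand side.
RHS : (n k i j : ℕ) → Set
RHS n k i j =
  Σ (List ℕ) λ π₁ → Σ (List ℕ) λ π₂ →
    IsDistinctPartition π₁ × IsPartition π₂ × durfee π₂ ≤ run π₁ ×
    (nparts π₁ + nparts π₂ ≡ k) × (nparts π₂ ≡ i) × (nparts π₁ ≡ j) ×
    (size π₁ + size π₂ ≡ n)

-- Removing the staircase (j, j−1, …, 1) from a partition into j distinct parts
-- leaves an arbitrary partition into at most j parts, and the Durfee square of
-- side d cuts π₂ into the square, an arm (the part of the first d rows to the
-- right of the square) and a leg whose parts are at most d. Square and leg are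
-- kept. With e = j − d, the condition l(π₂) ≤ j says that the arm fits in a
-- d × e box, while d ≤ r(π₁*) says that the staircase-reduced π₁* has at most e
-- nonzero parts, the arm of π₂* being unrestricted. It therefore suffices to
-- match, preserving total size,
--   (partitions into ≤ d + e parts) × (partitions in a d × e box)
--   (partitions into ≤ d parts)     × (partitions into ≤ e parts),
-- the bijective form of [d+e choose d]_q / (q)_{d+e} = 1 / ((q)_d (q)_e).
-- This is done by merging the two partitions of the second line and recording
-- in the box partition how their parts interleave.

module Submission where

open import Data.Bool using (true; false; T)
open import Data.Bool.Properties using (T-∧)
open import Data.Empty using (⊥-elim)
open import Data.List using (List; []; _∷_; [_]; length; replicate; reverse; map; take; drop; filter; _++_; applyDownFrom)
open import Data.List.Properties using (length-++; length-map; length-replicate; length-reverse; length-take; length-filter; filter-++; filter-all; filter-none; reverse-++; reverse-involutive; unfold-reverse; ++-identityʳ)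
open import Data.List.Membership.Propositional using (_∈_)
open import Data.List.Membership.Propositional.Properties using (∈-applyDownFrom⁺; ∈-++⁺ʳ)
open import Data.List.Relation.Binary.Permutation.Propositional.Properties using (↭-reverse)
open import Data.List.Relation.Unary.All using (All; []; _∷_)
import Data.List.Relation.Unary.All as All
open import Data.List.Relation.Unary.All.Properties using (map⁺; take⁺; drop⁺; ++⁺)
open import Data.List.Relation.Unary.Any using (here; there)
import Data.List.Relation.Unary.Any as Any
open import Data.List.Relation.Unary.Any.Properties using (any⁺; any⁻)
open import Data.List.Relation.Unary.Linked using (Linked; []; [-]; _∷_)
import Data.List.Relation.Unary.Linked as Linked
open import Data.List.Relation.Unary.Linked.Properties using (Linked⇒All)
open import Data.Nat using (ℕ; zero; suc; _+_; _*_; _∸_; _≤_; _<_; _≥_; _>_; _≤ᵇ_; _≡ᵇ_; z≤n; s≤s)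
open import Data.Nat.ListAction using (sum)
open import Data.Nat.ListAction.Properties using (sum-++; sum-↭)
open import Data.Nat.Properties
open import Data.Nat.Tactic.RingSolver using (solve-∀)
open import Data.Product using (Σ; _×_; _,_; proj₁; proj₂; ∃; uncurry)
open import Data.Sum using (inj₁; inj₂)
open import Data.Unit using (tt)
open import Function using (flip)
open import Function.Bundles using (Equivalence; _↔_; mk↔ₛ′)
open import Relation.Nullary using (Irrelevant; yes; no)
open import Relation.Binary.PropositionalEquality hiding ([_])
open import Defs

-- Merging gap vectors

-- weight g is the size of the partition whose smallest part is the head of g and
-- whose successive differences are the remaining entries of g.
weight : List ℕ → ℕ
weight []       = 0
weight (x ∷ xs) = suc (length xs) * x + weight xs

weight-zeros-++ : ∀ d ys → weight (replicate d 0 ++ ys) ≡ weight ys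
weight-zeros-++ zero    ys = refl
weight-zeros-++ (suc d) ys rewrite *-zeroʳ (length (replicate d 0 ++ ys)) = weight-zeros-++ d ys

length-zeros-++ : ∀ d (ys : List ℕ) → length (replicate d 0 ++ ys) ≡ d + length ys
length-zeros-++ d ys = trans (length-++ (replicate d 0)) (cong (_+ length ys) (length-replicate d))

bumpHead : List ℕ → List ℕ
bumpHead []       = []
bumpHead (w ∷ ws) = suc w ∷ ws

addHead : ℕ → List ℕ → List ℕ
addHead a []       = []
addHead a (w ∷ ws) = a + w ∷ ws

-- The parts of the two partitions are merged from the smallest up; ws records,
-- for each part of the first, how many parts of the second were taken since its
-- predecessor, and each of those lowers it by one (this is what makes the map
-- invertible). With length xs ≡ d and length ys ≡ e, the clauses meeting an
-- empty list before its counter reaches zero are unreachable.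
merge : (d e : ℕ) → List ℕ → List ℕ → List ℕ × List ℕ
merge zero    e       xs       ys       = ys , []
merge (suc d) zero    xs       ys       = xs , replicate (suc d) 0
merge (suc d) (suc e) []       ys       = [] , []
merge (suc d) (suc e) (x ∷ xs) []       = [] , []
merge (suc d) (suc e) (x ∷ xs) (y ∷ ys) with x ≤? y
... | yes _ = let (zs , ws) = merge d (suc e) xs (y ∸ x ∷ ys) in x ∷ zs , 0 ∷ ws
... | no  _ = let (zs , ws) = merge (suc d) e (x ∸ suc y ∷ xs) ys in y ∷ zs , bumpHead ws

unmerge : (d e : ℕ) → List ℕ → List ℕ → List ℕ × List ℕ
unmerge zero    e       zs       ws           = [] , zs
unmerge (suc d) zero    zs       ws           = zs , []
unmerge (suc d) (suc e) []       ws           = [] , []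
unmerge (suc d) (suc e) (z ∷ zs) []           = [] , []
unmerge (suc d) (suc e) (z ∷ zs) (zero ∷ ws)  =
  let (xs , ys) = unmerge d (suc e) zs ws in z ∷ xs , addHead z ys
unmerge (suc d) (suc e) (z ∷ zs) (suc w ∷ ws) =
  let (xs , ys) = unmerge (suc d) e zs (w ∷ ws) in addHead (suc z) xs , z ∷ ys

record MergeShape (d e : ℕ) (zws : List ℕ × List ℕ) : Set where
  field
    length-zs : length (proj₁ zws) ≡ d + e
    length-ws : length (proj₂ zws) ≡ d
    sum-ws≤e  : sum (proj₂ zws) ≤ e

record UnmergeShape (d e : ℕ) (xys : List ℕ × List ℕ) : Set where
  field
    length-xs : length (proj₁ xys) ≡ d
    length-ys : length (proj₂ xys) ≡ e

length-bumpHead : ∀ ws → length (bumpHead ws) ≡ length ws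
length-bumpHead []       = refl
length-bumpHead (w ∷ ws) = refl

sum-bumpHead : ∀ ws → sum (bumpHead ws) ≤ suc (sum ws)
sum-bumpHead []       = z≤n
sum-bumpHead (w ∷ ws) = ≤-refl

length-addHead : ∀ a ws → length (addHead a ws) ≡ length ws
length-addHead a []       = refl
length-addHead a (w ∷ ws) = refl

sum-replicate-zero : ∀ n → sum (replicate n 0) ≡ 0
sum-replicate-zero zero    = refl
sum-replicate-zero (suc n) = sum-replicate-zero n

merge-shape : ∀ d e xs ys → length xs ≡ d → length ys ≡ e → MergeShape d e (merge d e xs ys)
merge-shape zero    e       []       ys       _  ly = record { length-zs = ly ; length-ws = refl ; sum-ws≤e = z≤n }
merge-shape (suc d) zero    xs       ys       lx _  = record
  { length-zs = trans lx (sym (+-identityʳ (suc d)))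
  ; length-ws = length-replicate (suc d)
  ; sum-ws≤e  = ≤-reflexive (sum-replicate-zero (suc d)) }
merge-shape (suc d) (suc e) (x ∷ xs) (y ∷ ys) lx ly with x ≤? y
... | yes _ = record { length-zs = cong suc length-zs ; length-ws = cong suc length-ws ; sum-ws≤e = sum-ws≤e }
  where open MergeShape (merge-shape d (suc e) xs (y ∸ x ∷ ys) (suc-injective lx) ly)
... | no  _ = record
  { length-zs = trans (cong suc length-zs) (sym (+-suc (suc d) e))
  ; length-ws = trans (length-bumpHead ws) length-ws
  ; sum-ws≤e  = ≤-trans (sum-bumpHead ws) (s≤s sum-ws≤e) }
  where
  ws = proj₂ (merge (suc d) e (x ∸ suc y ∷ xs) ys)
  open MergeShape (merge-shape (suc d) e (x ∸ suc y ∷ xs) ys lx (suc-injective ly))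

unmerge-shape : ∀ d e zs ws → length zs ≡ d + e → length ws ≡ d → sum ws ≤ e →
                UnmergeShape d e (unmerge d e zs ws)
unmerge-shape zero    e       zs       ws           lz _  _  = record { length-xs = refl ; length-ys = lz }
unmerge-shape (suc d) zero    zs       ws           lz _  _  = record { length-xs = trans lz (+-identityʳ (suc d)) ; length-ys = refl }
unmerge-shape (suc d) (suc e) (z ∷ zs) (zero ∷ ws)  lz lw sw = record
  { length-xs = cong suc length-xs
  ; length-ys = trans (length-addHead z (proj₂ (unmerge d (suc e) zs ws))) length-ys }
  where open UnmergeShape (unmerge-shape d (suc e) zs ws (suc-injective lz) (suc-injective lw) sw)
unmerge-shape (suc d) (suc e) (z ∷ zs) (suc w ∷ ws) lz lw (s≤s sw) = record
  { length-xs = trans (length-addHead (suc z) (proj₁ (unmerge (suc d) e zs (w ∷ ws)))) length-xs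
  ; length-ys = cong suc length-ys }
  where open UnmergeShape (unmerge-shape (suc d) e zs (w ∷ ws) (trans (suc-injective lz) (+-suc d e)) lw sw)


unmerge-merge : ∀ d e xs ys → length xs ≡ d → length ys ≡ e →
                uncurry (unmerge d e) (merge d e xs ys) ≡ (xs , ys)
unmerge-merge zero    e       []       ys       _  _  = refl
unmerge-merge (suc d) zero    xs       []       _  _  = refl
unmerge-merge (suc d) (suc e) (x ∷ xs) (y ∷ ys) lx ly with x ≤? y
... | yes x≤y rewrite unmerge-merge d (suc e) xs (y ∸ x ∷ ys) (suc-injective lx) ly =
  cong (λ y′ → x ∷ xs , y′ ∷ ys) (m+[n∸m]≡n x≤y)
... | no x≰y with merge (suc d) e (x ∸ suc y ∷ xs) ys
                | unmerge-merge (suc d) e (x ∸ suc y ∷ xs) ys lx (suc-injective ly)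
                | MergeShape.length-ws (merge-shape (suc d) e (x ∸ suc y ∷ xs) ys lx (suc-injective ly))
...   | zs , []     | _  | ()
...   | zs , w ∷ ws | ih | _ rewrite ih = cong (λ x′ → x′ ∷ xs , y ∷ ys) (m+[n∸m]≡n (≰⇒> x≰y))

sum≤0⇒zeros : ∀ ws → sum ws ≤ 0 → ws ≡ replicate (length ws) 0
sum≤0⇒zeros []           _  = refl
sum≤0⇒zeros (zero ∷ ws)  sw = cong (0 ∷_) (sum≤0⇒zeros ws sw)

merge-unmerge : ∀ d e zs ws → length zs ≡ d + e → length ws ≡ d → sum ws ≤ e →
                uncurry (merge d e) (unmerge d e zs ws) ≡ (zs , ws)
merge-unmerge zero    e       zs []  _  _  _  = refl
merge-unmerge (suc d) zero    zs ws  _  lw sw = cong (zs ,_) (sym (trans (sum≤0⇒zeros ws sw) (cong (λ n → replicate n 0) lw)))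
merge-unmerge (suc d) (suc e) (z ∷ zs) (zero ∷ ws) lz lw sw
  with unmerge d (suc e) zs ws
     | merge-unmerge d (suc e) zs ws (suc-injective lz) (suc-injective lw) sw
     | UnmergeShape.length-ys (unmerge-shape d (suc e) zs ws (suc-injective lz) (suc-injective lw) sw)
... | xs , []     | _  | ()
... | xs , y ∷ ys | ih | _ with z ≤? z + y
...   | no  z≰z+y = ⊥-elim (z≰z+y (m≤m+n z y))
...   | yes _ rewrite m+n∸m≡n z y | ih = refl
merge-unmerge (suc d) (suc e) (z ∷ zs) (suc w ∷ ws) lz lw (s≤s sw)
  with unmerge (suc d) e zs (w ∷ ws)
     | merge-unmerge (suc d) e zs (w ∷ ws) (trans (suc-injective lz) (+-suc d e)) lw sw
     | UnmergeShape.length-xs (unmerge-shape (suc d) e zs (w ∷ ws) (trans (suc-injective lz) (+-suc d e)) lw sw)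
... | []     , ys | _  | ()
... | x ∷ xs , ys | ih | _ with suc z + x ≤? z
...   | yes z<z = ⊥-elim (<⇒≱ (s≤s (m≤m+n z x)) z<z)
...   | no  _ rewrite m+n∸m≡n (suc z) x | ih = refl

weight₂ : List ℕ × List ℕ → ℕ
weight₂ (zs , ws) = weight zs + weight ws

weight-merge : ∀ d e xs ys → length xs ≡ d → length ys ≡ e →
               weight₂ (merge d e xs ys) ≡ weight₂ (xs , ys)
weight-merge zero    e       []       ys       _  _  = +-identityʳ (weight ys)
weight-merge (suc d) zero    xs       []       _  _  =
  cong (weight xs +_) (trans (cong weight (sym (++-identityʳ (replicate (suc d) 0)))) (weight-zeros-++ (suc d) []))
weight-merge (suc d) (suc e) (x ∷ xs) (y ∷ ys) lx ly with x ≤? y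
... | yes x≤y
  with merge d (suc e) xs (y ∸ x ∷ ys)
     | weight-merge d (suc e) xs (y ∸ x ∷ ys) (suc-injective lx) ly
     | merge-shape d (suc e) xs (y ∸ x ∷ ys) (suc-injective lx) ly
...   | zs , ws | ih | shape
  rewrite MergeShape.length-zs shape | MergeShape.length-ws shape | suc-injective lx | suc-injective ly =
  step (m+[n∸m]≡n x≤y) ih
  where
  step : ∀ {t a b c f} → x + t ≡ y → a + b ≡ c + (suc e * t + f) →
          suc (d + suc e) * x + a + (d * 0 + b) ≡ suc d * x + c + (suc e * y + f)
  step {t} {a} {b} {c} {f} refl h = begin
    suc (d + suc e) * x + a + (d * 0 + b)       ≡⟨ regroup d e x a b ⟩
    suc (d + suc e) * x + (a + b)               ≡⟨ cong (suc (d + suc e) * x +_) h ⟩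
    suc (d + suc e) * x + (c + (suc e * t + f)) ≡⟨ distribute d e x t c f ⟩
    suc d * x + c + (suc e * (x + t) + f)       ∎
    where
    open ≡-Reasoning
    regroup : ∀ d e x a b → suc (d + suc e) * x + a + (d * 0 + b) ≡ suc (d + suc e) * x + (a + b)
    regroup = solve-∀
    distribute : ∀ d e x t c f → suc (d + suc e) * x + (c + (suc e * t + f)) ≡ suc d * x + c + (suc e * (x + t) + f)
    distribute = solve-∀
weight-merge (suc d) (suc e) (x ∷ xs) (y ∷ ys) lx ly | no x≰y
  with merge (suc d) e (x ∸ suc y ∷ xs) ys
     | weight-merge (suc d) e (x ∸ suc y ∷ xs) ys lx (suc-injective ly)
     | merge-shape (suc d) e (x ∸ suc y ∷ xs) ys lx (suc-injective ly)
...   | zs , []     | _  | shape = ⊥-elim (0≢1+n (MergeShape.length-ws shape))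
...   | zs , w ∷ ws | ih | shape
  rewrite MergeShape.length-zs shape | suc-injective (MergeShape.length-ws shape) | suc-injective lx | suc-injective ly =
  step (m+[n∸m]≡n (≰⇒> x≰y)) ih
  where
  step : ∀ {t a b c f} → suc y + t ≡ x → a + (suc d * w + b) ≡ suc d * t + c + f →
          suc (suc d + e) * y + a + (suc d * suc w + b) ≡ suc d * x + c + (suc e * y + f)
  step {t} {a} {b} {c} {f} refl h = begin
    suc (suc d + e) * y + a + (suc d * suc w + b)       ≡⟨ regroup d e y a w b ⟩
    suc (suc d + e) * y + suc d + (a + (suc d * w + b)) ≡⟨ cong (suc (suc d + e) * y + suc d +_) h ⟩
    suc (suc d + e) * y + suc d + (suc d * t + c + f)   ≡⟨ distribute d e y t c f ⟩
    suc d * (suc y + t) + c + (suc e * y + f)           ∎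
    where
    open ≡-Reasoning
    regroup : ∀ d e y a w b → suc (suc d + e) * y + a + (suc d * suc w + b) ≡ suc (suc d + e) * y + suc d + (a + (suc d * w + b))
    regroup = solve-∀
    distribute : ∀ d e y t c f → suc (suc d + e) * y + suc d + (suc d * t + c + f) ≡ suc d * (suc y + t) + c + (suc e * y + f)
    distribute = solve-∀

-- Gap vectors of partitions

diffs : List ℕ → List ℕ
diffs []          = []
diffs (x ∷ [])    = x ∷ []
diffs (x ∷ y ∷ r) = x ∸ y ∷ diffs (y ∷ r)

suffixSums : List ℕ → List ℕ
suffixSums []       = []
suffixSums (g ∷ gs) = sum (g ∷ gs) ∷ suffixSums gs

sum-diffs : ∀ x r → Linked _≥_ (x ∷ r) → sum (diffs (x ∷ r)) ≡ x
sum-diffs x []      _       = +-identityʳ x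
sum-diffs x (y ∷ r) (x≥y ∷ l) = trans (cong (x ∸ y +_) (sum-diffs y r l)) (m∸n+n≡m x≥y)

suffixSums-diffs : ∀ π → Linked _≥_ π → suffixSums (diffs π) ≡ π
suffixSums-diffs []          _       = refl
suffixSums-diffs (x ∷ [])    _       = cong [_] (+-identityʳ x)
suffixSums-diffs (x ∷ y ∷ r) (x≥y ∷ l) =
  cong₂ _∷_ (sum-diffs x (y ∷ r) (x≥y ∷ l)) (suffixSums-diffs (y ∷ r) l)

diffs-suffixSums : ∀ g → diffs (suffixSums g) ≡ g
diffs-suffixSums []          = refl
diffs-suffixSums (g ∷ [])    = cong [_] (+-identityʳ g)
diffs-suffixSums (g ∷ h ∷ r) = cong₂ _∷_ (m+n∸n≡m g (h + sum r)) (diffs-suffixSums (h ∷ r))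

suffixSums-linked : ∀ g → Linked _≥_ (suffixSums g)
suffixSums-linked []          = []
suffixSums-linked (g ∷ [])    = [-]
suffixSums-linked (g ∷ h ∷ r) = m≤n+m (h + sum r) g ∷ suffixSums-linked (h ∷ r)

suffixSums-≤-sum : ∀ g → All (_≤ sum g) (suffixSums g)
suffixSums-≤-sum []       = []
suffixSums-≤-sum (g ∷ gs) = ≤-refl ∷ All.map (λ p → ≤-trans p (m≤n+m (sum gs) g)) (suffixSums-≤-sum gs)

length-suffixSums : ∀ g → length (suffixSums g) ≡ length g
length-suffixSums []       = refl
length-suffixSums (g ∷ gs) = cong suc (length-suffixSums gs)

length-diffs : ∀ π → length (diffs π) ≡ length π
length-diffs []          = refl
length-diffs (x ∷ [])    = refl
length-diffs (x ∷ y ∷ r) = cong suc (length-diffs (y ∷ r))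

weight-∷ʳ : ∀ xs y → weight (xs ++ [ y ]) ≡ weight xs + sum xs + y
weight-∷ʳ []       y = trans (+-identityʳ (y + 0)) (+-identityʳ y)
weight-∷ʳ (x ∷ xs) y rewrite length-++ xs {[ y ]} | weight-∷ʳ xs y | +-comm (length xs) 1 =
  regroup (length xs) x (weight xs) (sum xs) y
  where
  regroup : ∀ n x a s y → suc (suc n) * x + (a + s + y) ≡ suc n * x + a + (x + s) + y
  regroup = solve-∀

sum-reverse : ∀ xs → sum (reverse xs) ≡ sum xs
sum-reverse xs = sum-↭ (↭-reverse xs)

sum-suffixSums : ∀ g → sum (suffixSums g) ≡ weight (reverse g)
sum-suffixSums []       = refl
sum-suffixSums (g ∷ gs)
  rewrite unfold-reverse g gs | weight-∷ʳ (reverse gs) g | sum-reverse gs | sum-suffixSums gs =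
  regroup g (sum gs) (weight (reverse gs))
  where
  regroup : ∀ g s a → g + s + a ≡ a + s + g
  regroup = solve-∀

strictDiffs : List ℕ → List ℕ
strictDiffs []          = []
strictDiffs (x ∷ [])    = x ∸ 1 ∷ []
strictDiffs (x ∷ y ∷ r) = x ∸ suc y ∷ strictDiffs (y ∷ r)

strictSuffixSums : List ℕ → List ℕ
strictSuffixSums []       = []
strictSuffixSums (g ∷ gs) = sum (g ∷ gs) + length (g ∷ gs) ∷ strictSuffixSums gs

staircase : ℕ → List ℕ
staircase = applyDownFrom suc

length-strictDiffs : ∀ π → length (strictDiffs π) ≡ length π
length-strictDiffs []          = refl
length-strictDiffs (x ∷ [])    = refl
length-strictDiffs (x ∷ y ∷ r) = cong suc (length-strictDiffs (y ∷ r))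

length-strictSuffixSums : ∀ g → length (strictSuffixSums g) ≡ length g
length-strictSuffixSums []       = refl
length-strictSuffixSums (g ∷ gs) = cong suc (length-strictSuffixSums gs)

sum-strictDiffs : ∀ x r → IsDistinctPartition (x ∷ r) → sum (strictDiffs (x ∷ r)) + length (x ∷ r) ≡ x
sum-strictDiffs x []      (x≥1 ∷ [] , _) = trans (cong (_+ 1) (+-identityʳ (x ∸ 1))) (m∸n+n≡m x≥1)
sum-strictDiffs x (y ∷ r) (_ ∷ pos , x>y ∷ l) = begin
  x ∸ suc y + sum (strictDiffs (y ∷ r)) + suc (length (y ∷ r))   ≡⟨ regroup (x ∸ suc y) (sum (strictDiffs (y ∷ r))) (length (y ∷ r)) ⟩
  x ∸ suc y + suc (sum (strictDiffs (y ∷ r)) + length (y ∷ r))   ≡⟨ cong (λ u → x ∸ suc y + suc u) (sum-strictDiffs y r (pos , l)) ⟩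
  x ∸ suc y + suc y                                             ≡⟨ m∸n+n≡m x>y ⟩
  x                                                             ∎
  where
  open ≡-Reasoning
  regroup : ∀ a b c → a + b + suc c ≡ a + suc (b + c)
  regroup = solve-∀

strictSuffixSums-strictDiffs : ∀ π → IsDistinctPartition π → strictSuffixSums (strictDiffs π) ≡ π
strictSuffixSums-strictDiffs []          _ = refl
strictSuffixSums-strictDiffs (x ∷ [])    D = cong [_] (sum-strictDiffs x [] D)
strictSuffixSums-strictDiffs (x ∷ y ∷ r) D@(_ ∷ pos , _ ∷ l) = cong₂ _∷_
  (trans (cong (sum (strictDiffs (x ∷ y ∷ r)) +_) (length-strictDiffs (x ∷ y ∷ r))) (sum-strictDiffs x (y ∷ r) D))
  (strictSuffixSums-strictDiffs (y ∷ r) (pos , l))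

strictDiffs-strictSuffixSums : ∀ g → strictDiffs (strictSuffixSums g) ≡ g
strictDiffs-strictSuffixSums []          = refl
strictDiffs-strictSuffixSums (g ∷ [])    = cong [_] (trans (cong (_∸ 1) (+-comm (g + 0) 1)) (+-identityʳ g))
strictDiffs-strictSuffixSums (g ∷ h ∷ r) = cong₂ _∷_ head-gap (strictDiffs-strictSuffixSums (h ∷ r))
  where
  s = h + sum r
  n = length r
  head-gap : g + s + suc (suc n) ∸ suc (s + suc n) ≡ g
  head-gap = trans (cong (_∸ suc (s + suc n)) (regroup g s n)) (m+n∸n≡m g (suc (s + suc n)))
    where
    regroup : ∀ g s n → g + s + suc (suc n) ≡ g + suc (s + suc n)
    regroup = solve-∀

strictSuffixSums-distinct : ∀ g → IsDistinctPartition (strictSuffixSums g)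
strictSuffixSums-distinct g = positive g , decreasing g
  where
  positive : ∀ g → All (1 ≤_) (strictSuffixSums g)
  positive []       = []
  positive (g ∷ gs) = ≤-trans (s≤s z≤n) (m≤n+m (suc (length gs)) (sum (g ∷ gs))) ∷ positive gs
  decreasing : ∀ g → Linked _>_ (strictSuffixSums g)
  decreasing []          = []
  decreasing (g ∷ [])    = [-]
  decreasing (g ∷ h ∷ r) = +-mono-≤-< (m≤n+m (h + sum r) g) (n<1+n (suc (length r))) ∷ decreasing (h ∷ r)

sum-strictSuffixSums : ∀ g → sum (strictSuffixSums g) ≡ sum (suffixSums g) + sum (staircase (length g))
sum-strictSuffixSums []       = refl
sum-strictSuffixSums (g ∷ gs) rewrite sum-strictSuffixSums gs =
  regroup (g + sum gs) (length gs) (sum (suffixSums gs)) (sum (staircase (length gs)))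
  where
  regroup : ∀ a n b t → a + suc n + (b + t) ≡ a + b + (suc n + t)
  regroup = solve-∀

strictDiffs-staircase : ∀ d → strictDiffs (staircase d) ≡ replicate d 0
strictDiffs-staircase zero          = refl
strictDiffs-staircase (suc zero)    = refl
strictDiffs-staircase (suc (suc d)) = cong₂ _∷_ (n∸n≡0 (suc d)) (strictDiffs-staircase (suc d))

strictDiffs-++-staircase : ∀ ρ d → ∃ λ pre → strictDiffs (ρ ++ staircase d) ≡ pre ++ replicate d 0
strictDiffs-++-staircase []          d       = [] , strictDiffs-staircase d
strictDiffs-++-staircase (x ∷ [])    zero    = x ∸ 1 ∷ [] , refl
strictDiffs-++-staircase (x ∷ [])    (suc d) = x ∸ suc (suc d) ∷ [] , cong (x ∸ suc (suc d) ∷_) (strictDiffs-staircase (suc d))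
strictDiffs-++-staircase (x ∷ y ∷ r) d       =
  let pre , eq = strictDiffs-++-staircase (y ∷ r) d in x ∸ suc y ∷ pre , cong (x ∸ suc y ∷_) eq

strictSuffixSums-zeros : ∀ d → strictSuffixSums (replicate d 0) ≡ staircase d
strictSuffixSums-zeros zero    = refl
strictSuffixSums-zeros (suc d) rewrite sum-replicate-zero d | length-replicate d {0} = cong (suc d ∷_) (strictSuffixSums-zeros d)

strictSuffixSums-++-zeros : ∀ gs d → ∃ λ pre → strictSuffixSums (gs ++ replicate d 0) ≡ pre ++ staircase d
strictSuffixSums-++-zeros []       d = [] , strictSuffixSums-zeros d
strictSuffixSums-++-zeros (g ∷ gs) d =
  let pre , eq = strictSuffixSums-++-zeros gs d
      top = sum (g ∷ gs ++ replicate d 0) + length (g ∷ gs ++ replicate d 0)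
  in top ∷ pre , cong (top ∷_) eq

-- Gap vectors are read from the smallest part upwards, so that the size is the
-- weight; for distinct parts the staircase is removed first.
gaps : List ℕ → List ℕ
gaps π = reverse (diffs π)

ofGaps : List ℕ → List ℕ
ofGaps g = suffixSums (reverse g)

strictGaps : List ℕ → List ℕ
strictGaps π = reverse (strictDiffs π)

ofStrictGaps : List ℕ → List ℕ
ofStrictGaps g = strictSuffixSums (reverse g)

ofGaps-gaps : ∀ π → Linked _≥_ π → ofGaps (gaps π) ≡ π
ofGaps-gaps π l rewrite reverse-involutive (diffs π) = suffixSums-diffs π l

gaps-ofGaps : ∀ g → gaps (ofGaps g) ≡ g
gaps-ofGaps g rewrite diffs-suffixSums (reverse g) = reverse-involutive g

length-gaps : ∀ π → length (gaps π) ≡ length π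
length-gaps π = trans (length-reverse (diffs π)) (length-diffs π)

length-ofGaps : ∀ g → length (ofGaps g) ≡ length g
length-ofGaps g = trans (length-suffixSums (reverse g)) (length-reverse g)

ofGaps-linked : ∀ g → Linked _≥_ (ofGaps g)
ofGaps-linked g = suffixSums-linked (reverse g)

sum-ofGaps : ∀ g → sum (ofGaps g) ≡ weight g
sum-ofGaps g = trans (sum-suffixSums (reverse g)) (cong weight (reverse-involutive g))

ofGaps-≤-sum : ∀ g → All (_≤ sum g) (ofGaps g)
ofGaps-≤-sum g = subst (λ s → All (_≤ s) (ofGaps g)) (sum-reverse g) (suffixSums-≤-sum (reverse g))

sum-gaps-≤ : ∀ {b} π → Linked _≥_ π → All (_≤ b) π → sum (gaps π) ≤ b
sum-gaps-≤ []      _ _         = z≤n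
sum-gaps-≤ (x ∷ r) l (x≤b ∷ _) = subst (_≤ _) (sym (trans (sum-reverse (diffs (x ∷ r))) (sum-diffs x r l))) x≤b

ofStrictGaps-strictGaps : ∀ π → IsDistinctPartition π → ofStrictGaps (strictGaps π) ≡ π
ofStrictGaps-strictGaps π D rewrite reverse-involutive (strictDiffs π) = strictSuffixSums-strictDiffs π D

strictGaps-ofStrictGaps : ∀ g → strictGaps (ofStrictGaps g) ≡ g
strictGaps-ofStrictGaps g rewrite strictDiffs-strictSuffixSums (reverse g) = reverse-involutive g

length-strictGaps : ∀ π → length (strictGaps π) ≡ length π
length-strictGaps π = trans (length-reverse (strictDiffs π)) (length-strictDiffs π)

length-ofStrictGaps : ∀ g → length (ofStrictGaps g) ≡ length g
length-ofStrictGaps g = trans (length-strictSuffixSums (reverse g)) (length-reverse g)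

ofStrictGaps-distinct : ∀ g → IsDistinctPartition (ofStrictGaps g)
ofStrictGaps-distinct g = strictSuffixSums-distinct (reverse g)

sum-ofStrictGaps : ∀ g → sum (ofStrictGaps g) ≡ weight g + sum (staircase (length g))
sum-ofStrictGaps g = trans (sum-strictSuffixSums (reverse g))
  (cong₂ (λ w n → w + sum (staircase n)) (sum-ofGaps g) (length-reverse g))

reverse-replicate : ∀ n (x : ℕ) → reverse (replicate n x) ≡ replicate n x
reverse-replicate zero    x = refl
reverse-replicate (suc n) x = begin
  reverse (x ∷ replicate n x) ≡⟨ unfold-reverse x (replicate n x) ⟩
  reverse (replicate n x) ++ [ x ] ≡⟨ cong (_++ [ x ]) (reverse-replicate n x) ⟩
  replicate n x ++ [ x ] ≡⟨ replicate-∷ʳ n ⟩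
  x ∷ replicate n x ∎
  where
  open ≡-Reasoning
  replicate-∷ʳ : ∀ n → replicate n x ++ [ x ] ≡ x ∷ replicate n x
  replicate-∷ʳ zero    = refl
  replicate-∷ʳ (suc n) = cong (x ∷_) (replicate-∷ʳ n)

ofStrictGaps-zeros-++ : ∀ d ys → ∃ λ pre → ofStrictGaps (replicate d 0 ++ ys) ≡ pre ++ staircase d
ofStrictGaps-zeros-++ d ys
  rewrite reverse-++ (replicate d 0) ys | reverse-replicate d 0 = strictSuffixSums-++-zeros (reverse ys) d

strictGaps-++-staircase : ∀ ρ d → ∃ λ ys → strictGaps (ρ ++ staircase d) ≡ replicate d 0 ++ ys
strictGaps-++-staircase ρ d =
  let pre , eq = strictDiffs-++-staircase ρ d in
  reverse pre , trans (cong reverse eq) (trans (reverse-++ pre (replicate d 0)) (cong (_++ reverse pre) (reverse-replicate d 0)))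

drop-zeros-++ : ∀ d (ys : List ℕ) → drop d (replicate d 0 ++ ys) ≡ ys
drop-zeros-++ zero    ys = refl
drop-zeros-++ (suc d) ys = drop-zeros-++ d ys

-- Durfee squares

arm : ℕ → List ℕ → List ℕ
arm d π = map (_∸ d) (take d π)

leg : ℕ → List ℕ → List ℕ
leg = drop

join : ℕ → List ℕ → List ℕ → List ℕ
join d γ L = map (_+ d) γ ++ L

join-arm-leg : ∀ d π → All (d ≤_) (take d π) → join d (arm d π) (leg d π) ≡ π
join-arm-leg d π = go d π
  where
  go : ∀ k π → All (d ≤_) (take k π) → map (_+ d) (map (_∸ d) (take k π)) ++ drop k π ≡ π
  go zero    π       _          = refl
  go (suc k) []      _          = refl
  go (suc k) (x ∷ π) (d≤x ∷ ps) = cong₂ _∷_ (m∸n+n≡m d≤x) (go k π ps)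

arm-join : ∀ d γ L → length γ ≡ d → arm d (join d γ L) ≡ γ
arm-join d γ L refl = go γ
  where
  go : ∀ γ′ → map (_∸ d) (take (length γ′) (map (_+ d) γ′ ++ L)) ≡ γ′
  go []       = refl
  go (g ∷ γ′) = cong₂ _∷_ (m+n∸n≡m g d) (go γ′)

leg-join : ∀ d γ L → length γ ≡ d → leg d (join d γ L) ≡ L
leg-join d γ L refl = go γ
  where
  go : ∀ γ′ → drop (length γ′) (map (_+ d) γ′ ++ L) ≡ L
  go []       = refl
  go (g ∷ γ′) = go γ′

countGe-++ : ∀ t xs ys → countGe t (xs ++ ys) ≡ countGe t xs + countGe t ys
countGe-++ t xs ys = trans (cong length (filter-++ (t ≤?_) xs ys)) (length-++ (filter (t ≤?_) xs))

countGe-all : ∀ {t xs} → All (t ≤_) xs → countGe t xs ≡ length xs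
countGe-all {t} ps = cong length (filter-all (t ≤?_) ps)

countGe-none : ∀ {t xs} → All (_< t) xs → countGe t xs ≡ 0
countGe-none {t} ps = cong length (filter-none (t ≤?_) (All.map <⇒≱ ps))

durfeeFrom-≡ : ∀ π d n → d ≤ n → d ≤ countGe d π → (∀ e → d < e → e ≤ n → countGe e π < e) →
               durfeeFrom n π ≡ d
durfeeFrom-≡ π zero zero    _   _    _     = refl
durfeeFrom-≡ π d    (suc n) d≤n d-ok above with m≤n⇒m<n∨m≡n d≤n | suc n ≤ᵇ countGe (suc n) π in test
... | inj₂ refl      | true  = refl
... | inj₂ refl      | false = ⊥-elim (subst T test (≤⇒≤ᵇ d-ok))
... | inj₁ (s≤s d≤n′) | true  = ⊥-elim (<⇒≱ (above (suc n) (s≤s d≤n′) ≤-refl) (≤ᵇ⇒≤ (suc n) _ (subst T (sym test) tt)))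
... | inj₁ (s≤s d≤n′) | false = durfeeFrom-≡ π d n d≤n′ d-ok (λ e d<e e≤n → above e d<e (m≤n⇒m≤1+n e≤n))

length-join : ∀ d γ L → length (join d γ L) ≡ length γ + length L
length-join d γ L = trans (length-++ (map (_+ d) γ)) (cong (_+ length L) (length-map (_+ d) γ))

durfee-join : ∀ d γ L → length γ ≡ d → All (_≤ d) L → durfee (join d γ L) ≡ d
durfee-join d γ L refl L≤d = durfeeFrom-≡ π d (length π) d≤length d-ok above
  where
  π = join d γ L
  count : ∀ e → countGe e π ≡ countGe e (map (_+ d) γ) + countGe e L
  count e = countGe-++ e (map (_+ d) γ) L
  rows≥d : All (d ≤_) (map (_+ d) γ)
  rows≥d = map⁺ (All.universal (m≤n+m d) γ)
  d≤length : d ≤ length π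
  d≤length = subst (d ≤_) (sym (length-join d γ L)) (m≤m+n d (length L))
  d-ok : d ≤ countGe d π
  d-ok rewrite count d | countGe-all rows≥d | length-map (_+ d) γ = m≤m+n d (countGe d L)
  above : ∀ e → d < e → e ≤ length π → countGe e π < e
  above e d<e _ rewrite count e | countGe-none (All.map (λ x≤d → <-≤-trans (s≤s x≤d) d<e) L≤d) | +-identityʳ (countGe e (map (_+ d) γ)) =
    ≤-<-trans (≤-trans (length-filter (e ≤?_) (map (_+ d) γ)) (≤-reflexive (length-map (_+ d) γ))) d<e

record DurfeeSquare (π : List ℕ) (d : ℕ) : Set where
  field
    d≤length : d ≤ length π
    rows≥d   : All (d ≤_) (take d π)
    leg≤d    : All (_≤ d) (leg d π)

first-row : ∀ k x m π → k < x → Linked _≥_ (x ∷ π) → m ≤ length π → All (suc k + m ≤_) (take m π) →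
            k + suc m ≤ x
first-row k x zero    π       k<x _         _   _        = subst (_≤ x) (+-comm 1 k) k<x
first-row k x (suc m) (y ∷ π) _   (x≥y ∷ _) _   (y≥ ∷ _) = ≤-trans (≤-reflexive (+-suc k (suc m))) (≤-trans y≥ x≥y)

-- Peel off rows while the current row is longer than k plus the number of rows
-- already taken; the first row that fails bounds every row below it.
square-split : ∀ k π → Linked _≥_ π →
               ∃ λ m → m ≤ length π × All (k + m ≤_) (take m π) × All (_≤ k + m) (drop m π)
square-split k []      _ = 0 , z≤n , [] , []
square-split k (x ∷ π) l with x ≤? k
... | yes x≤k = 0 , z≤n , [] , subst (λ b → All (_≤ b) (x ∷ π)) (sym (+-identityʳ k)) (Linked⇒All (flip ≤-trans) x≤k l)
... | no x≰k with square-split (suc k) π (Linked.tail l)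
...   | m , m≤ , rows , rest = suc m , s≤s m≤ , first-row k x m π (≰⇒> x≰k) l m≤ rows ∷ shift {_≤_} rows , shift {flip _≤_} rest
  where
  shift : ∀ {P : ℕ → ℕ → Set} {ys} → All (P (suc k + m)) ys → All (P (k + suc m)) ys
  shift {P} {ys} = subst (λ b → All (P b) ys) (sym (+-suc k m))

length-arm : ∀ d π → d ≤ length π → length (arm d π) ≡ d
length-arm d π d≤ = trans (length-map (_∸ d) (take d π)) (trans (length-take d π) (m≤n⇒m⊓n≡m d≤))

durfee-square : ∀ π → Linked _≥_ π → DurfeeSquare π (durfee π)
durfee-square π l with square-split 0 π l
... | m , m≤ , rows , rest = subst (DurfeeSquare π) (sym durfee≡m)
  record { d≤length = m≤ ; rows≥d = rows ; leg≤d = rest }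
  where
  durfee≡m : durfee π ≡ m
  durfee≡m = subst (λ π′ → durfee π′ ≡ m) (join-arm-leg m π rows)
                   (durfee-join m (arm m π) (leg m π) (length-arm m π m≤) rest)

durfee-≤ : ∀ {π d j} → DurfeeSquare π d → All (_≤ j) π → d ≤ j
durfee-≤ {d = zero} _ _ = z≤n
durfee-≤ {x ∷ π} {suc d} sq (x≤j ∷ _) with DurfeeSquare.rows≥d sq
... | d≤x ∷ _ = ≤-trans d≤x x≤j

arm-linked : ∀ d π → Linked _≥_ π → Linked _≥_ (arm d π)
arm-linked d π = go d π
  where
  go : ∀ k π → Linked _≥_ π → Linked _≥_ (map (_∸ d) (take k π))
  go zero          π           _         = []
  go (suc k)       []          _         = []
  go (suc zero)    (x ∷ π)     _         = [-]
  go (suc (suc k)) (x ∷ [])    _         = [-]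
  go (suc (suc k)) (x ∷ y ∷ π) (x≥y ∷ l) = ∸-monoˡ-≤ d x≥y ∷ go (suc k) (y ∷ π) l

arm-≤ : ∀ {j} d π → All (_≤ j) π → All (_≤ j ∸ d) (arm d π)
arm-≤ d π ps = map⁺ (All.map (∸-monoˡ-≤ d) (take⁺ d ps))

leg-partition : ∀ d π → IsPartition π → IsPartition (leg d π)
leg-partition d π (pos , l) = drop⁺ d pos , linked-drop d π l
  where
  linked-drop : ∀ n π → Linked _≥_ π → Linked _≥_ (drop n π)
  linked-drop zero    π       l = l
  linked-drop (suc n) []      l = l
  linked-drop (suc n) (x ∷ π) l = linked-drop n π (Linked.tail l)

cons-linked : ∀ {b g L} → b ≤ g → All (_≤ b) L → Linked _≥_ L → Linked _≥_ (g ∷ L)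
cons-linked _   []        [] = [-]
cons-linked b≤g (y≤b ∷ _) l  = ≤-trans y≤b b≤g ∷ l

join-partition : ∀ d γ L → Linked _≥_ γ → length γ ≡ d → IsPartition L → All (_≤ d) L → IsPartition (join d γ L)
join-partition d [] L _ _ P _ = P
join-partition d γ@(_ ∷ _) L lγ refl (posL , lL) L≤d = positive γ , decreasing γ lγ
  where
  positive : ∀ γ′ → All (1 ≤_) (map (_+ length γ) γ′ ++ L)
  positive []       = posL
  positive (g ∷ γ′) = ≤-trans (s≤s z≤n) (m≤n+m (length γ) g) ∷ positive γ′
  decreasing : ∀ γ′ → Linked _≥_ γ′ → Linked _≥_ (map (_+ length γ) γ′ ++ L)
  decreasing []           _         = lL
  decreasing (g ∷ [])     _         = cons-linked (m≤n+m (length γ) g) L≤d lL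
  decreasing (g ∷ h ∷ γ′) (g≥h ∷ l) = +-monoˡ-≤ (length γ) g≥h ∷ decreasing (h ∷ γ′) l

sum-join : ∀ d γ L → sum (join d γ L) ≡ sum γ + length γ * d + sum L
sum-join d γ L = trans (sum-++ (map (_+ d) γ) L) (cong (_+ sum L) (sum-map-+ γ))
  where
  sum-map-+ : ∀ γ → sum (map (_+ d) γ) ≡ sum γ + length γ * d
  sum-map-+ []      = refl
  sum-map-+ (g ∷ γ) rewrite sum-map-+ γ = regroup g d (sum γ) (length γ)
    where
    regroup : ∀ g d s n → g + d + (s + n * d) ≡ g + s + (d + n * d)
    regroup = solve-∀

largest-≤⇒All : ∀ {j} π → largest π ≤ j → All (_≤ j) π
largest-≤⇒All []      _ = []
largest-≤⇒All (x ∷ π) h = ≤-trans (m≤m⊔n x (largest π)) h ∷ largest-≤⇒All π (≤-trans (m≤n⊔m x (largest π)) h)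

All⇒largest-≤ : ∀ {j} π → All (_≤ j) π → largest π ≤ j
All⇒largest-≤ []      _           = z≤n
All⇒largest-≤ (x ∷ π) (x≤j ∷ π≤j) = ⊔-lub x≤j (All⇒largest-≤ π π≤j)

-- Distinct partitions ending in a staircase

HasPartsUpTo : ℕ → List ℕ → Set
HasPartsUpTo d π = ∀ {i} → i < d → suc i ∈ π

isPart⇒∈ : ∀ k π → T (isPart k π) → k ∈ π
isPart⇒∈ k π t = Any.map (≡ᵇ⇒≡ k _) (any⁻ (k ≡ᵇ_) π t)

∈⇒isPart : ∀ k π → k ∈ π → T (isPart k π)
∈⇒isPart k π k∈π = any⁺ (k ≡ᵇ_) (Any.map (≡⇒≡ᵇ k _) k∈π)

allUpTo-sound : ∀ d π → T (allUpTo d π) → HasPartsUpTo d π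
allUpTo-sound (suc d) π t {i} i<1+d with Equivalence.to T-∧ t | m≤n⇒m<n∨m≡n (≤-pred i<1+d)
... | t-d , _   | inj₂ refl = isPart⇒∈ (suc d) π t-d
... | _   , t-< | inj₁ i<d  = allUpTo-sound d π t-< i<d

allUpTo-complete : ∀ d π → HasPartsUpTo d π → T (allUpTo d π)
allUpTo-complete zero    π _   = _
allUpTo-complete (suc d) π has = Equivalence.from T-∧
  (∈⇒isPart (suc d) π (has (n<1+n d)) , allUpTo-complete d π (λ i<d → has (m<n⇒m<1+n i<d)))

runFrom-≤ : ∀ n π → runFrom n π ≤ n
runFrom-≤ zero    π = z≤n
runFrom-≤ (suc n) π with allUpTo (suc n) π
... | true  = ≤-refl
... | false = m≤n⇒m≤1+n (runFrom-≤ n π)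

runFrom-sound : ∀ n π → T (allUpTo (runFrom n π) π)
runFrom-sound zero    π = _
runFrom-sound (suc n) π with allUpTo (suc n) π in test
... | true  = subst T (sym test) _
... | false = runFrom-sound n π

runFrom-≥ : ∀ n π d → T (allUpTo d π) → d ≤ n → d ≤ runFrom n π
runFrom-≥ zero    π zero _ _   = z≤n
runFrom-≥ (suc n) π d    t d≤n with allUpTo (suc n) π in test | m≤n⇒m<n∨m≡n d≤n
... | true  | _               = d≤n
... | false | inj₁ (s≤s d≤n′) = runFrom-≥ n π d t d≤n′
... | false | inj₂ refl       = ⊥-elim (subst T test t)

run-≤-length : ∀ π → run π ≤ length π
run-≤-length π = runFrom-≤ (length π) π

≤-run⇒HasPartsUpTo : ∀ {d} π → d ≤ run π → HasPartsUpTo d π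
≤-run⇒HasPartsUpTo π d≤run i<d = allUpTo-sound (run π) π (runFrom-sound (length π) π) (<-≤-trans i<d d≤run)

HasPartsUpTo⇒≤-run : ∀ {d} π → HasPartsUpTo d π → d ≤ length π → d ≤ run π
HasPartsUpTo⇒≤-run {d} π has d≤length = runFrom-≥ (length π) π d (allUpTo-complete d π has) d≤length

below-head : ∀ {x π} → Linked _>_ (x ∷ π) → All (_< x) π
below-head [-]       = []
below-head (x>y ∷ l) = Linked⇒All (flip <-trans) x>y l

staircase-unique : ∀ d π → IsDistinctPartition π → All (_≤ d) π → HasPartsUpTo d π → π ≡ staircase d
staircase-unique zero    []      _               _          _   = refl
staircase-unique zero    (x ∷ π) (1≤x ∷ _ , _)   (x≤0 ∷ _)  _   = ⊥-elim (<⇒≱ 1≤x x≤0)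
staircase-unique (suc d) []      _               _          has with has (n<1+n d)
... | ()
staircase-unique (suc d) (x ∷ π) (_ ∷ pos , l)   (x≤ ∷ _)   has with has (n<1+n d)
... | there d+1∈π = ⊥-elim (<⇒≱ (All.lookup (below-head l) d+1∈π) x≤)
... | here refl   = cong (suc d ∷_) (staircase-unique d π (pos , Linked.tail l) (All.map ≤-pred (below-head l)) has′)
  where
  has′ : HasPartsUpTo d π
  has′ i<d with has (m<n⇒m<1+n i<d)
  ... | here i+1≡d+1 = ⊥-elim (<-irrefl (suc-injective i+1≡d+1) i<d)
  ... | there i+1∈π  = i+1∈π

ends-with-staircase : ∀ d π → IsDistinctPartition π → HasPartsUpTo d π → ∃ λ ρ → π ≡ ρ ++ staircase d
ends-with-staircase zero    []      _ _   = [] , refl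
ends-with-staircase (suc d) []      _ has with has (n<1+n d)
... | ()
ends-with-staircase d (x ∷ π) D@(_ ∷ pos , l) has with x ≤? d
... | yes x≤d = [] , staircase-unique d (x ∷ π) D (x≤d ∷ All.map (λ y<x → ≤-trans (<⇒≤ y<x) x≤d) (below-head l)) has
... | no  x≰d = let ρ , eq = ends-with-staircase d π (pos , Linked.tail l) has′ in x ∷ ρ , cong (x ∷_) eq
  where
  has′ : HasPartsUpTo d π
  has′ i<d with has i<d
  ... | here i+1≡x  = ⊥-elim (x≰d (subst (_≤ d) i+1≡x i<d))
  ... | there i+1∈π = i+1∈π

strictGaps-≤-run : ∀ {d} π → IsDistinctPartition π → d ≤ run π → strictGaps π ≡ replicate d 0 ++ drop d (strictGaps π)
strictGaps-≤-run {d} π D d≤run =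
  let ρ , π≡ = ends-with-staircase d π D (≤-run⇒HasPartsUpTo π d≤run)
      ys , eq = strictGaps-++-staircase ρ d
      gaps≡ = trans (cong strictGaps π≡) eq
  in trans gaps≡ (cong (replicate d 0 ++_) (sym (trans (cong (drop d) gaps≡) (drop-zeros-++ d ys))))

≤-run-ofStrictGaps : ∀ d ys → d ≤ run (ofStrictGaps (replicate d 0 ++ ys))
≤-run-ofStrictGaps d ys =
  let pre , eq = ofStrictGaps-zeros-++ d ys
      π = ofStrictGaps (replicate d 0 ++ ys)
      has : HasPartsUpTo d π
      has i<d = subst (_ ∈_) (sym eq) (∈-++⁺ʳ pre (∈-applyDownFrom⁺ suc i<d))
      d≤length : d ≤ length π
      d≤length = subst (d ≤_) (sym (trans (length-ofStrictGaps (replicate d 0 ++ ys)) (length-zeros-++ d ys))) (m≤m+n d (length ys))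
  in HasPartsUpTo⇒≤-run π has d≤length

-- Bijections between sets of pairs of partitions

Pair : Set
Pair = List ℕ × List ℕ

PairRel : Set₁
PairRel = List ℕ → List ℕ → Set

Admissible : PairRel → Pair → Set
Admissible R (π₁ , π₂) = IsDistinctPartition π₁ × IsPartition π₂ × R π₁ π₂

PairSet : PairRel → (n k i j : ℕ) → Set
PairSet R n k i j =
  Σ (List ℕ) λ π₁ → Σ (List ℕ) λ π₂ →
    IsDistinctPartition π₁ × IsPartition π₂ × R π₁ π₂ ×
    (nparts π₁ + nparts π₂ ≡ k) × (nparts π₂ ≡ i) × (nparts π₁ ≡ j) ×
    (size π₁ + size π₂ ≡ n)

record SameStatistics (p q : Pair) : Set where
  field
    nparts₁ : nparts (proj₁ q) ≡ nparts (proj₁ p)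
    nparts₂ : nparts (proj₂ q) ≡ nparts (proj₂ p)
    size₁₂  : size (proj₁ q) + size (proj₂ q) ≡ size (proj₁ p) + size (proj₂ p)

record PairBijection (R S : PairRel) : Set where
  field
    to           : Pair → Pair
    from         : Pair → Pair
    to-admissible   : ∀ p → Admissible R p → Admissible S (to p)
    from-admissible : ∀ q → Admissible S q → Admissible R (from q)
    to-statistics   : ∀ p → Admissible R p → SameStatistics p (to p)
    from-statistics : ∀ q → Admissible S q → SameStatistics q (from q)
    from-to      : ∀ p → Admissible R p → from (to p) ≡ p
    to-from      : ∀ q → Admissible S q → to (from q) ≡ q

distinct-irrelevant : ∀ {π} → Irrelevant (IsDistinctPartition π)
distinct-irrelevant (a , l) (a′ , l′) = cong₂ _,_ (All.irrelevant ≤-irrelevant a a′) (Linked.irrelevant <-irrelevant l l′)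

partition-irrelevant : ∀ {π} → Irrelevant (IsPartition π)
partition-irrelevant (a , l) (a′ , l′) = cong₂ _,_ (All.irrelevant ≤-irrelevant a a′) (Linked.irrelevant ≤-irrelevant l l′)

module _ {R : PairRel} {n k i j : ℕ} where

  pairOf : PairSet R n k i j → Pair
  pairOf (π₁ , π₂ , _) = π₁ , π₂

  pairOf-admissible : (x : PairSet R n k i j) → Admissible R (pairOf x)
  pairOf-admissible (_ , _ , D , P , r , _) = D , P , r

  PairSet-≡ : (∀ {π₁ π₂} → Irrelevant (R π₁ π₂)) → ∀ (x y : PairSet R n k i j) → pairOf x ≡ pairOf y → x ≡ y
  PairSet-≡ R-irrelevant (π₁ , π₂ , D , P , r , e₁ , e₂ , e₃ , e₄) (.π₁ , .π₂ , D′ , P′ , r′ , e₁′ , e₂′ , e₃′ , e₄′) refl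
    rewrite distinct-irrelevant D D′ | partition-irrelevant P P′ | R-irrelevant r r′
          | ≡-irrelevant e₁ e₁′ | ≡-irrelevant e₂ e₂′ | ≡-irrelevant e₃ e₃′ | ≡-irrelevant e₄ e₄′ = refl

transport : ∀ {R S n k i j} (f : Pair → Pair) → (∀ p → Admissible R p → Admissible S (f p)) →
            (∀ p → Admissible R p → SameStatistics p (f p)) → PairSet R n k i j → PairSet S n k i j
transport f adm stat (π₁ , π₂ , D , P , r , ek , ei , ej , en) =
  let D′ , P′ , s = adm (π₁ , π₂) (D , P , r)
      open SameStatistics (stat (π₁ , π₂) (D , P , r))
  in proj₁ (f (π₁ , π₂)) , proj₂ (f (π₁ , π₂)) , D′ , P′ , s ,
     trans (cong₂ _+_ nparts₁ nparts₂) ek , trans nparts₂ ei , trans nparts₁ ej , trans size₁₂ en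

PairSet-↔ : ∀ {R S} → (∀ {π₁ π₂} → Irrelevant (R π₁ π₂)) → (∀ {π₁ π₂} → Irrelevant (S π₁ π₂)) →
            PairBijection R S → ∀ n k i j → PairSet R n k i j ↔ PairSet S n k i j
PairSet-↔ R-irr S-irr bij n k i j = mk↔ₛ′
  (transport to to-admissible to-statistics)
  (transport from from-admissible from-statistics)
  (λ y → PairSet-≡ S-irr _ y (to-from (pairOf y) (pairOf-admissible y)))
  (λ x → PairSet-≡ R-irr _ x (from-to (pairOf x) (pairOf-admissible x)))
  where open PairBijection bij

-- The bijection

LargestBounded : PairRel
LargestBounded π₁ π₂ = largest π₂ ≤ nparts π₁

DurfeeBounded : PairRel
DurfeeBounded π₁ π₂ = durfee π₂ ≤ run π₁

toDurfeeBounded : Pair → Pair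
toDurfeeBounded (π₁ , π₂) =
  let d = durfee π₂
      xs , ys = unmerge d (length π₁ ∸ d) (strictGaps π₁) (gaps (arm d π₂))
  in ofStrictGaps (replicate d 0 ++ ys) , join d (ofGaps xs) (leg d π₂)

toLargestBounded : Pair → Pair
toLargestBounded (π₁ , π₂) =
  let d = durfee π₂
      zs , ws = merge d (length π₁ ∸ d) (gaps (arm d π₂)) (drop d (strictGaps π₁))
  in ofStrictGaps zs , join d (ofGaps ws) (leg d π₂)

size-via-gaps : ∀ {d} g h g′ h′ L → length h ≡ d → length h′ ≡ d → length g′ ≡ length g →
                weight g′ + weight h′ ≡ weight g + weight h →
                size (ofStrictGaps g′) + size (join d (ofGaps h′) L) ≡ size (ofStrictGaps g) + size (join d (ofGaps h) L)
size-via-gaps {d} g h g′ h′ L lh lh′ lg′ w≡ = begin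
  size (ofStrictGaps g′) + size (join d (ofGaps h′) L)       ≡⟨ formula g′ h′ lh′ ⟩
  weight g′ + weight h′ + (sum (staircase (length g′)) + d * d + sum L) ≡⟨ cong₂ (λ w n → w + (sum (staircase n) + d * d + sum L)) w≡ lg′ ⟩
  weight g + weight h + (sum (staircase (length g)) + d * d + sum L)   ≡⟨ formula g h lh ⟨
  size (ofStrictGaps g) + size (join d (ofGaps h) L)         ∎
  where
  open ≡-Reasoning
  formula : ∀ g h → length h ≡ d →
            size (ofStrictGaps g) + size (join d (ofGaps h) L) ≡ weight g + weight h + (sum (staircase (length g)) + d * d + sum L)
  formula g h lh rewrite sum-join d (ofGaps h) L | sum-ofStrictGaps g | sum-ofGaps h | length-ofGaps h | lh =
    regroup (weight g) (sum (staircase (length g))) (weight h) (d * d) (sum L)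
    where
    regroup : ∀ a s b q l → a + s + (b + q + l) ≡ a + b + (s + q + l)
    regroup = solve-∀

module DurfeeParts (π : List ℕ) (P : IsPartition π) where
  d = durfee π
  A = arm d π
  L = leg d π
  square = durfee-square π (proj₂ P)
  open DurfeeSquare square public

  length-A : length A ≡ d
  length-A = length-arm d π d≤length

  A-linked : Linked _≥_ A
  A-linked = arm-linked d π (proj₂ P)

  L-partition : IsPartition L
  L-partition = leg-partition d π P

  π≡ : join d (ofGaps (gaps A)) L ≡ π
  π≡ = trans (cong (λ a → join d a L) (ofGaps-gaps A A-linked)) (join-arm-leg d π rows≥d)

  length-π : length π ≡ d + length L
  length-π = trans (cong length (sym (join-arm-leg d π rows≥d))) (trans (length-join d A L) (cong (_+ length L) length-A))

module Assembled (d : ℕ) (h L : List ℕ) (length-h : length h ≡ d) (L-partition : IsPartition L) (L≤d : All (_≤ d) L) where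
  π = join d (ofGaps h) L

  length-arm′ : length (ofGaps h) ≡ d
  length-arm′ = trans (length-ofGaps h) length-h

  partition : IsPartition π
  partition = join-partition d (ofGaps h) L (ofGaps-linked h) length-arm′ L-partition L≤d

  durfee≡ : durfee π ≡ d
  durfee≡ = durfee-join d (ofGaps h) L length-arm′ L≤d

  gaps-arm : gaps (arm d π) ≡ h
  gaps-arm = trans (cong gaps (arm-join d (ofGaps h) L length-arm′)) (gaps-ofGaps h)

  leg≡ : leg d π ≡ L
  leg≡ = leg-join d (ofGaps h) L length-arm′

  length≡ : length π ≡ d + length L
  length≡ = trans (length-join d (ofGaps h) L) (cong (_+ length L) length-arm′)

module FromLargestBounded (π₁ π₂ : List ℕ) (D : IsDistinctPartition π₁) (P : IsPartition π₂) (bound : LargestBounded π₁ π₂) where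
  open DurfeeParts π₂ P
  j = length π₁
  e = j ∸ d
  Z = strictGaps π₁
  W = gaps A

  π₂≤j : All (_≤ j) π₂
  π₂≤j = largest-≤⇒All π₂ bound

  d≤j : d ≤ j
  d≤j = durfee-≤ square π₂≤j

  length-Z : length Z ≡ d + e
  length-Z = trans (length-strictGaps π₁) (sym (m+[n∸m]≡n d≤j))

  length-W : length W ≡ d
  length-W = trans (length-gaps A) length-A

  sum-W : sum W ≤ e
  sum-W = sum-gaps-≤ A A-linked (arm-≤ d π₂ π₂≤j)

  X = proj₁ (unmerge d e Z W)
  Y = proj₂ (unmerge d e Z W)
  open UnmergeShape (unmerge-shape d e Z W length-Z length-W sum-W)
  open Assembled d X L length-xs L-partition leg≤d renaming (π to out₂)

  out₁ = ofStrictGaps (replicate d 0 ++ Y)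

  length-zeros-Y : length (replicate d 0 ++ Y) ≡ length Z
  length-zeros-Y = trans (length-zeros-++ d Y) (trans (cong (d +_) length-ys) (sym length-Z))

  admissible : Admissible DurfeeBounded (toDurfeeBounded (π₁ , π₂))
  admissible = ofStrictGaps-distinct (replicate d 0 ++ Y) , partition , subst (_≤ run out₁) (sym durfee≡) (≤-run-ofStrictGaps d Y)

  statistics : SameStatistics (π₁ , π₂) (toDurfeeBounded (π₁ , π₂))
  statistics = record
    { nparts₁ = trans (length-ofStrictGaps (replicate d 0 ++ Y)) (trans length-zeros-Y (length-strictGaps π₁))
    ; nparts₂ = trans length≡ (sym length-π)
    ; size₁₂  = subst₂ (λ a b → size out₁ + size out₂ ≡ size a + size b) (ofStrictGaps-strictGaps π₁ D) π≡
                  (size-via-gaps Z W (replicate d 0 ++ Y) X L length-W length-xs length-zeros-Y weights) }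
    where
    weights : weight (replicate d 0 ++ Y) + weight X ≡ weight Z + weight W
    weights = begin
      weight (replicate d 0 ++ Y) + weight X ≡⟨ cong (_+ weight X) (weight-zeros-++ d Y) ⟩
      weight Y + weight X ≡⟨ +-comm (weight Y) (weight X) ⟩
      weight₂ (X , Y) ≡⟨ weight-merge d e X Y length-xs length-ys ⟨
      weight₂ (merge d e X Y) ≡⟨ cong weight₂ (merge-unmerge d e Z W length-Z length-W sum-W) ⟩
      weight Z + weight W ∎
      where open ≡-Reasoning

  round-trip : toLargestBounded (toDurfeeBounded (π₁ , π₂)) ≡ (π₁ , π₂)
  length-out₁ : length out₁ ≡ j
  length-out₁ = SameStatistics.nparts₁ statistics

  round-trip rewrite durfee≡ | length-out₁ | gaps-arm | strictGaps-ofStrictGaps (replicate d 0 ++ Y) | drop-zeros-++ d Y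
                   | merge-unmerge d e Z W length-Z length-W sum-W | leg≡ =
    cong₂ _,_ (ofStrictGaps-strictGaps π₁ D) π≡

module FromDurfeeBounded (π₁ π₂ : List ℕ) (D : IsDistinctPartition π₁) (P : IsPartition π₂) (bound : DurfeeBounded π₁ π₂) where
  open DurfeeParts π₂ P
  j = length π₁
  e = j ∸ d
  X = gaps A
  Y = drop d (strictGaps π₁)

  d≤j : d ≤ j
  d≤j = ≤-trans bound (run-≤-length π₁)

  strictGaps≡ : strictGaps π₁ ≡ replicate d 0 ++ Y
  strictGaps≡ = strictGaps-≤-run π₁ D bound

  length-X : length X ≡ d
  length-X = trans (length-gaps A) length-A

  length-Y : length Y ≡ e
  length-Y = begin
    length Y                                     ≡⟨ m+n∸m≡n d (length Y) ⟨
    d + length Y ∸ d                             ≡⟨ cong (_∸ d) (length-zeros-++ d Y) ⟨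
    length (replicate d 0 ++ Y) ∸ d              ≡⟨ cong (λ g → length g ∸ d) strictGaps≡ ⟨
    length (strictGaps π₁) ∸ d                   ≡⟨ cong (_∸ d) (length-strictGaps π₁) ⟩
    e                                            ∎
    where open ≡-Reasoning

  Z = proj₁ (merge d e X Y)
  W = proj₂ (merge d e X Y)
  open MergeShape (merge-shape d e X Y length-X length-Y)
  open Assembled d W L length-ws L-partition leg≤d renaming (π to out₂)

  out₁ = ofStrictGaps Z

  length-out₁ : length out₁ ≡ j
  length-out₁ = trans (length-ofStrictGaps Z) (trans length-zs (m+[n∸m]≡n d≤j))

  out₂≤j : All (_≤ j) out₂
  out₂≤j = subst (λ b → All (_≤ b) out₂) (m∸n+n≡m d≤j)
    (++⁺ (map⁺ (All.map (λ w≤e → +-monoˡ-≤ d w≤e) (All.map (λ w≤ → ≤-trans w≤ sum-ws≤e) (ofGaps-≤-sum W))))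
         (All.map (λ x≤d → ≤-trans x≤d (m≤n+m d e)) leg≤d))

  admissible : Admissible LargestBounded (toLargestBounded (π₁ , π₂))
  admissible = ofStrictGaps-distinct Z , partition , subst (largest out₂ ≤_) (sym length-out₁) (All⇒largest-≤ out₂ out₂≤j)

  statistics : SameStatistics (π₁ , π₂) (toLargestBounded (π₁ , π₂))
  statistics = record
    { nparts₁ = length-out₁
    ; nparts₂ = trans length≡ (sym length-π)
    ; size₁₂  = subst₂ (λ a b → size out₁ + size out₂ ≡ size a + size b)
                  (trans (cong ofStrictGaps (sym strictGaps≡)) (ofStrictGaps-strictGaps π₁ D)) π≡
                  (size-via-gaps (replicate d 0 ++ Y) X Z W L length-X length-ws length-Z weights) }
    where
    length-Z : length Z ≡ length (replicate d 0 ++ Y)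
    length-Z = trans length-zs (sym (trans (length-zeros-++ d Y) (cong (d +_) length-Y)))
    weights : weight Z + weight W ≡ weight (replicate d 0 ++ Y) + weight X
    weights = begin
      weight₂ (merge d e X Y)                ≡⟨ weight-merge d e X Y length-X length-Y ⟩
      weight X + weight Y                    ≡⟨ +-comm (weight X) (weight Y) ⟩
      weight Y + weight X                    ≡⟨ cong (_+ weight X) (weight-zeros-++ d Y) ⟨
      weight (replicate d 0 ++ Y) + weight X ∎
      where open ≡-Reasoning

  round-trip : toDurfeeBounded (toLargestBounded (π₁ , π₂)) ≡ (π₁ , π₂)
  round-trip rewrite durfee≡ | length-out₁ | strictGaps-ofStrictGaps Z | gaps-arm
                   | unmerge-merge d e X Y length-X length-Y | leg≡ =
    cong₂ _,_ (trans (cong ofStrictGaps (sym strictGaps≡)) (ofStrictGaps-strictGaps π₁ D)) π≡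

durfeeBijection : PairBijection LargestBounded DurfeeBounded
durfeeBijection = record
  { to              = toDurfeeBounded
  ; from            = toLargestBounded
  ; to-admissible   = λ { (π₁ , π₂) (D , P , r) → FromLargestBounded.admissible π₁ π₂ D P r }
  ; from-admissible = λ { (π₁ , π₂) (D , P , r) → FromDurfeeBounded.admissible π₁ π₂ D P r }
  ; to-statistics   = λ { (π₁ , π₂) (D , P , r) → FromLargestBounded.statistics π₁ π₂ D P r }
  ; from-statistics = λ { (π₁ , π₂) (D , P , r) → FromDurfeeBounded.statistics π₁ π₂ D P r }
  ; from-to         = λ { (π₁ , π₂) (D , P , r) → FromLargestBounded.round-trip π₁ π₂ D P r }
  ; to-from         = λ { (π₁ , π₂) (D , P , r) → FromDurfeeBounded.round-trip π₁ π₂ D P r }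
  }

theorem5 : (n k i j : ℕ) → LHS n k i j ↔ RHS n k i j
theorem5 = PairSet-↔ ≤-irrelevant ≤-irrelevant durfeeBijection
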